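{- Let $A$ be a finite set of prisoners with $|A|\ge2$, $K$ a set of colors with $|K|\ge2$, $V$ a visibility graph on $A$, and $I$ an inning function on $A$ with $IN\ge2$. Suppose the hat game $\mathcal{G}=(A,K,V,I)$ satisfies (S1) $I_1=\{s\}$ for a single prisoner $s$, and (S3) for every $a\in A$, $V(a)\cap H(a)=\emptyset$, and let $P$ be a predictor for $\mathcal{G}$, produced by strategies $(S_a)_{a\in A}$ with guesses $(\sigma_a)_{a\in A}$, such that for every coloring at most one prisoner guesses incorrectly. Then: (1) $V(s)=A\setminus\{s\}$; (2) for every coloring $f\in K^A$ and every $a\in A$, if $P(f)(a)\ne f(a)$ then $a=s$; (3) for every coloring $f$, every $a\in A\setminus\{s\}$ and every $k'\in K$ with $k'\ne f(a)$, letting $f'$ be $f$ with the value at $a$ changed to $k'$, we have $P(f)(s)\ne P(f')(s)$; (4) if $K$ is finite, then for every coloring $f$, every $a\in A\setminus\{s\}$ and every $k'\in K$ with $k'\neq h_a^f(s)$, letting $h'$ be $h_a^f$ with the value at $s$ changed to $k'$, we have $S_a(h_a^f, f\restriction V(a))\neq S_a(h', f\restriction V(a))$.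
   Context: A hat game $(A,K,V,I)$ consists of: a set $A$ of prisoners and a set $K$ of colors (with $|A|,|K|\ge2$); a visibility graph $V\subseteq A^2$ with no loops, where $(a,b)\in V$ means $a$ sees $b$'s hat, and $V(a)=\{b:(a,b)\in V\}$; and an inning function $I$, a surjection from $A$ onto $\{\beta:1\le\beta\le\alpha\}$ for some nonzero ordinal $\alpha$. Write $IN=\max\operatorname{ran}(I)$, $I_\beta=\{a:I(a)=\beta\}$, and $H(a)=\{b:I(b)<I(a)\}$. A coloring is $f\in K^A$. Strategies: for each $a$, a function $S_a:K^{H(a)}\times K^{V(a)}\to K$; guesses are defined by recursion on $I(a)$ as $\sigma_a(f)=S_a(h_a^f,f\restriction V(a))$ with $h_a^f=(\sigma_b(f))_{b\in H(a)}\in K^{H(a)}$. A predictor is $P:K^A\to K^A$ with $P(f)(a)=\sigma_a(f)$ for some family of strategies. Prisoner $a$ guesses incorrectly under $f$ if $P(f)(a)\ne f(a)$. -}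

module Defs where

open import Data.Nat using (ℕ; _<_; _<?_)
open import Data.Fin using (Fin; _≟_)
open import Data.Bool using (Bool; true; false; if_then_else_)
open import Data.Maybe using (Maybe; just; nothing)
open import Data.Vec using (Vec; tabulate)
open import Relation.Nullary.Decidable using (⌊_⌋)
open import Relation.Binary.PropositionalEquality using (_≡_)

-- Prisoners are A = Fin n.
-- A visibility graph is a Boolean relation V : A → A → Bool,
-- (a sees b  iff  V a b ≡ true).
-- An inning function is I : A → ℕ (with range {1,…,IN}, imposed in the statement).

inH : {n : ℕ} (I : Fin n → ℕ) (a b : Fin n) → Bool
inH I a b = ⌊ I b <? I a ⌋

-- Encoding of an element of K^X (X ⊆ A given by a Boolean predicate P):
-- the vector whose b-th entry is  just (g b)  if b ∈ X, and  nothing  otherwise.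
-- A function on K^X is thus a function on Vec (Maybe K) n (its values on
-- vectors that do not encode an element of K^X are irrelevant).
restrict : {n : ℕ} {K : Set} (P : Fin n → Bool) (g : Fin n → K) → Vec (Maybe K) n
restrict P g = tabulate (λ b → if P b then just (g b) else nothing)

history : {n : ℕ} {K : Set} (I : Fin n → ℕ) (a : Fin n) (g : Fin n → K) → Vec (Maybe K) n
history I a g = restrict (inH I a) g

view : {n : ℕ} {K : Set} (V : Fin n → Fin n → Bool) (a : Fin n) (f : Fin n → K) → Vec (Maybe K) n
view V a f = restrict (V a) f

-- A strategy for prisoner a: a function K^{H(a)} × K^{V(a)} → K.
Strategies : ℕ → Set → Set
Strategies n K = Fin n → Vec (Maybe K) n → Vec (Maybe K) n → K

-- σ is the family of guesses produced by the strategies S: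
--   σ_a(f) = S_a(h_a^f, f ↾ V(a))   with  h_a^f = (σ_b(f))_{b ∈ H(a)}.
-- (By well-founded recursion on I(a) there is exactly one such σ.)
GuessesOf : {n : ℕ} {K : Set} (V : Fin n → Fin n → Bool) (I : Fin n → ℕ)
  (S : Strategies n K) (σ : (Fin n → K) → Fin n → K) → Set
GuessesOf V I S σ = ∀ f a → σ f a ≡ S a (history I a (σ f)) (view V a f)

update : {n : ℕ} {K : Set} (f : Fin n → K) (a : Fin n) (k : K) → Fin n → K
update f a k b = if ⌊ b ≟ a ⌋ then k else f b

{-# OPTIONS --safe #-}
module Submission where

-- Nobody sees s: every other prisoner plays after s and sees no earlier
-- player.  So no guess depends on f s, and if some a ≠ s guessed wrongly,
-- recolouring s would make s wrong too; hence only s ever errs.  Then the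
-- history of a ≠ s consists of true colours and of s's guess, so two
-- colourings that differ only at a and give s the same guess give a the same
-- history and view, and a cannot be right under both: this is (3), and (1)
-- follows because s's guess depends on nothing but what s sees.  For (4),
-- with K finite the injective map k ↦ σ (f[a≔k]) s is onto, so the history
-- h_a^f with s's entry changed to k′ is the history a really receives under
-- some recolouring of a, where a's answer must differ from its answer under f.

open import Defs
open import Data.Nat using (ℕ; suc; _≤_; _<_; s≤s)
open import Data.Nat.Properties using (≤-refl; ≤-trans; <-irrefl; <-asym; ≤∧≢⇒<; n<1+n)
open import Data.Fin using (Fin; zero; suc; _≟_)
open import Data.Fin.Properties using (any?; <⇒notInjective; sequence; inj⇒≟)
open import Data.Bool using (Bool; true; false; if_then_else_)
open import Data.Bool.Properties using (T-≡)
open import Data.Maybe using (just; nothing)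
open import Data.Vec using (lookup; tabulate; _[_]≔_)
open import Data.Vec.Properties using (tabulate-cong; tabulate∘lookup; lookup∘tabulate; lookup∘update; lookup∘update′)
open import Data.Vec.Functional using (_∷_)
open import Data.Empty using (⊥-elim)
open import Data.Product using (Σ; ∃; _×_; _,_; proj₁; proj₂)
import Data.Product as Product
open import Effect.Monad using (RawMonad)
open import Function using (_∘_; const; Injective; _↔_; Inverse; Injection; Equivalence)
open import Function.Properties.Inverse using (↔⇒↣; ↔-sym)
open import Relation.Binary.Definitions using (DecidableEquality)
open import Relation.Binary.PropositionalEquality using (_≡_; _≢_; _≗_; refl; sym; trans; cong; cong₂; module ≡-Reasoning)
open import Relation.Nullary using (¬_; yes; no; contradiction)
open import Relation.Nullary.Decidable using (toWitness; fromWitness)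
open import Relation.Nullary.Negation using (¬¬-Monad)

open ≡-Reasoning

Fin-injective⇒surjective : ∀ {m} (h : Fin m → Fin m) → Injective _≡_ _≡_ h → ∀ y → ∃ λ x → h x ≡ y
Fin-injective⇒surjective {m} h h-injective y with any? (λ x → h x ≟ y)
... | yes hit = hit
... | no miss = ⊥-elim (<⇒notInjective (n<1+n m) y∷h-injective)
  where
  y∷h-injective : Injective _≡_ _≡_ (y ∷ h)
  y∷h-injective {zero}  {zero}   _ = refl
  y∷h-injective {zero}  {suc x}  y≡hx = contradiction (x , sym y≡hx) miss
  y∷h-injective {suc x} {zero}   hx≡y = contradiction (x , hx≡y) miss
  y∷h-injective {suc x} {suc x′} hx≡hx′ = cong suc (h-injective hx≡hx′)

finite-injective⇒surjective : {K : Set} → (Σ ℕ λ m → K ↔ Fin m) →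
  (g : K → K) → Injective _≡_ _≡_ g → ∀ y → ∃ λ x → g x ≡ y
finite-injective⇒surjective (m , K↔Fin) g g-injective y =
  Product.map from to-injective
    (Fin-injective⇒surjective (to ∘ g ∘ from)
      (λ e → from-injective (g-injective (to-injective e))) (to y))
  where
  open Inverse K↔Fin using (to; from)
  to-injective : Injective _≡_ _≡_ to
  to-injective = Injection.injective (↔⇒↣ K↔Fin)
  from-injective : Injective _≡_ _≡_ from
  from-injective = Injection.injective (↔⇒↣ (↔-sym K↔Fin))

module _ {n : ℕ} where

  inH⇒< : (I : Fin n → ℕ) {a c : Fin n} → inH I a c ≡ true → I c < I a
  inH⇒< I c∈H = toWitness (Equivalence.from T-≡ c∈H)

  <⇒inH : (I : Fin n → ℕ) {a c : Fin n} → I c < I a → inH I a c ≡ true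
  <⇒inH I Ic<Ia = Equivalence.to T-≡ (fromWitness Ic<Ia)

  seen≢unseen : (V : Fin n → Fin n → Bool) {a b c : Fin n} → V a b ≡ false → V a c ≡ true → c ≢ b
  seen≢unseen V Vab Vac refl = contradiction (trans (sym Vac) Vab) λ ()

  sole-first-inning : {I : Fin n → ℕ} {s : Fin n} → (∀ a → 1 ≤ I a) → (∀ a → I a ≡ 1 → a ≡ s) →
                      I s ≡ 1 → ∀ a → a ≢ s → I s < I a
  sole-first-inning {I} positive only-s Is≡1 a a≢s rewrite Is≡1 =
    ≤∧≢⇒< (positive a) (λ 1≡Ia → a≢s (only-s a (sym 1≡Ia)))

  nothing-before-first : {I : Fin n → ℕ} {s : Fin n} → (∀ a → a ≢ s → I s < I a) → ∀ c → ¬ I c < I s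
  nothing-before-first {s = s} s-first c Ic<Is with c ≟ s
  ... | yes refl = <-irrefl refl Ic<Is
  ... | no c≢s   = <-asym Ic<Is (s-first c c≢s)

  first-unseen : {V : Fin n → Fin n → Bool} {I : Fin n → ℕ} {s : Fin n} →
                 (∀ a → V a a ≡ false) → (∀ a b → V a b ≡ true → ¬ I b < I a) →
                 (∀ a → a ≢ s → I s < I a) → ∀ b → V b s ≢ true
  first-unseen {V} {s = s} irreflexive no-earlier-seen s-first b Vbs with b ≟ s
  ... | yes refl = seen≢unseen V (irreflexive s) Vbs refl
  ... | no b≢s   = no-earlier-seen b s Vbs (s-first b b≢s)

module _ {n : ℕ} {K : Set} where

  update-same : (f : Fin n → K) (a : Fin n) (k : K) → update f a k a ≡ k
  update-same f a k with a ≟ a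
  ... | yes _   = refl
  ... | no a≢a = contradiction refl a≢a

  update-other : (f : Fin n → K) {a b : Fin n} (k : K) → b ≢ a → update f a k b ≡ f b
  update-other f {a} {b} k b≢a with b ≟ a
  ... | yes b≡a = contradiction b≡a b≢a
  ... | no _    = refl

  update-id : (f : Fin n → K) (a : Fin n) → update f a (f a) ≗ f
  update-id f a b with b ≟ a
  ... | yes refl = refl
  ... | no _     = refl

  AgreeOff : Fin n → (Fin n → K) → (Fin n → K) → Set
  AgreeOff a f f′ = ∀ c → c ≢ a → f c ≡ f′ c

  agreeOff-update : (f : Fin n → K) (a : Fin n) (k : K) → AgreeOff a f (update f a k)
  agreeOff-update f a k c c≢a = sym (update-other f k c≢a)

  restrict-cong : (P : Fin n → Bool) {g g′ : Fin n → K} →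
                  (∀ c → P c ≡ true → g c ≡ g′ c) → restrict P g ≡ restrict P g′
  restrict-cong P {g} {g′} agree = tabulate-cong entry
    where
    entry : ∀ c → (if P c then just (g c) else nothing) ≡ (if P c then just (g′ c) else nothing)
    entry c with P c in Pc
    ... | true  = cong just (agree c Pc)
    ... | false = refl

  restrict-update : (P : Fin n → Bool) (g : Fin n → K) {a : Fin n} (k : K) → P a ≡ true →
                    restrict P g [ a ]≔ just k ≡ restrict P (update g a k)
  restrict-update P g {a} k Pa = begin
    restrict P g [ a ]≔ just k                      ≡⟨ tabulate∘lookup _ ⟨
    tabulate (lookup (restrict P g [ a ]≔ just k))  ≡⟨ tabulate-cong entry ⟩
    restrict P (update g a k)                       ∎
    where
    entry : ∀ b → lookup (restrict P g [ a ]≔ just k) b ≡ (if P b then just (update g a k b) else nothing)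
    entry b with b ≟ a
    ... | yes refl rewrite Pa = lookup∘update b (restrict P g) (just k)
    ... | no b≢a = trans (lookup∘update′ b≢a (restrict P g) (just k)) (lookup∘tabulate _ b)

  history-cong : (I : Fin n → ℕ) (a : Fin n) {g g′ : Fin n → K} →
                 (∀ c → I c < I a → g c ≡ g′ c) → history I a g ≡ history I a g′
  history-cong I a agree = restrict-cong (inH I a) (λ c c∈H → agree c (inH⇒< I c∈H))

  view-cong : (V : Fin n → Fin n → Bool) (a : Fin n) {f f′ : Fin n → K} →
              (∀ c → V a c ≡ true → f c ≡ f′ c) → view V a f ≡ view V a f′
  view-cong V a = restrict-cong (V a)

module Game {n : ℕ} {K : Set} {V : Fin n → Fin n → Bool} {I : Fin n → ℕ}
            {S : Strategies n K} {σ : (Fin n → K) → Fin n → K}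
            (guesses : GuessesOf V I S σ) where

  guess-cong : ∀ {f f′} a → history I a (σ f) ≡ history I a (σ f′) → view V a f ≡ view V a f′ →
               σ f a ≡ σ f′ a
  guess-cong {f} {f′} a same-history same-view = begin
    σ f a                                   ≡⟨ guesses f a ⟩
    S a (history I a (σ f)) (view V a f)    ≡⟨ cong₂ (S a) same-history same-view ⟩
    S a (history I a (σ f′)) (view V a f′)  ≡⟨ guesses f′ a ⟨
    σ f′ a                                  ∎

  guesses-cong : ∀ {f f′} → (∀ b c → V b c ≡ true → f c ≡ f′ c) → σ f ≗ σ f′
  guesses-cong {f} {f′} agree-on-seen a = before (suc (I a)) a ≤-refl
    where
    before : ∀ β b → I b < β → σ f b ≡ σ f′ b
    before (suc β) b (s≤s Ib≤β) = guess-cong b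
      (history-cong I b (λ c Ic<Ib → before β c (≤-trans Ic<Ib Ib≤β)))
      (view-cong V b (agree-on-seen b))

  unseen-only-error : {k₀ k₁ : K} → k₀ ≢ k₁ → (s : Fin n) → (∀ b → V b s ≢ true) →
    (∀ f a b → σ f a ≢ f a → σ f b ≢ f b → a ≡ b) → ∀ f a → σ f a ≢ f a → a ≡ s
  unseen-only-error {k₀} {k₁} k₀≢k₁ s unseen at-most-one-error f a a-wrong with a ≟ s
  ... | yes a≡s = a≡s
  ... | no a≢s  = ⊥-elim (s-guess-is k₀ λ e₀ → s-guess-is k₁ λ e₁ → k₀≢k₁ (trans (sym e₀) e₁))
    where
    s-guess-is : ∀ k → ¬ ¬ (σ f s ≡ k)
    s-guess-is k s-wrong = a≢s (at-most-one-error f′ a s a-wrong′ s-wrong′)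
      where
      f′ : Fin n → K
      f′ = update f s k
      same-guesses : σ f ≗ σ f′
      same-guesses = guesses-cong λ b c Vbc → sym (update-other f k λ { refl → unseen b Vbc })
      a-wrong′ : σ f′ a ≢ f′ a
      a-wrong′ e = a-wrong (trans (same-guesses a) (trans e (update-other f k a≢s)))
      s-wrong′ : σ f′ s ≢ f′ s
      s-wrong′ e = s-wrong (trans (same-guesses s) (trans e (update-same f s k)))

  module OnlyErrorAt (s : Fin n) (only-s-errs : ∀ f a → σ f a ≢ f a → a ≡ s) where

    OthersCorrect : (Fin n → K) → Set
    OthersCorrect f = ∀ c → c ≢ s → σ f c ≡ f c

    -- K need not have decidable equality, so this holds only up to double
    -- negation; every use below has goal ⊥.
    others-correct : ∀ f → ¬ ¬ OthersCorrect f
    others-correct f = sequence (RawMonad.rawApplicative ¬¬-Monad) correct-unless-s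
      where
      correct-unless-s : ∀ c → ¬ ¬ (c ≢ s → σ f c ≡ f c)
      correct-unless-s c ¬correct =
        ¬correct λ c≢s → contradiction (only-s-errs f c (¬correct ∘ const)) c≢s

    history-of-variant : ∀ {a f f′} → OthersCorrect f → OthersCorrect f′ → AgreeOff a f f′ →
                         history I a (σ f′) ≡ history I a (update (σ f) s (σ f′ s))
    history-of-variant {a} {f} {f′} correct correct′ agree = history-cong I a entry
      where
      entry : ∀ c → I c < I a → σ f′ c ≡ update (σ f) s (σ f′ s) c
      entry c Ic<Ia with c ≟ s
      ... | yes refl = refl
      ... | no c≢s   = begin
        σ f′ c                     ≡⟨ correct′ c c≢s ⟩
        f′ c                       ≡⟨ agree c (λ { refl → <-irrefl refl Ic<Ia }) ⟨
        f c                        ≡⟨ correct c c≢s ⟨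
        σ f c                      ∎

    history-of-later-variant : ∀ {a f f′} → I s < I a → OthersCorrect f → OthersCorrect f′ → AgreeOff a f f′ →
                               history I a (σ f′) ≡ history I a (σ f) [ s ]≔ just (σ f′ s)
    history-of-later-variant {a} {f} {f′} s<a correct correct′ agree =
      trans (history-of-variant correct correct′ agree)
            (sym (restrict-update (inH I a) (σ f) (σ f′ s) (<⇒inH I s<a)))

    variant-changes-s-guess : ∀ {a f f′} → a ≢ s → V a a ≡ false → AgreeOff a f f′ → f a ≢ f′ a →
                              σ f s ≢ σ f′ s
    variant-changes-s-guess {a} {f} {f′} a≢s blind agree differ same-s-guess =
      others-correct f λ correct → others-correct f′ λ correct′ → differ (begin
        f a     ≡⟨ correct a a≢s ⟨
        σ f a   ≡⟨ guess-cong a (same-history correct correct′) same-view ⟩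
        σ f′ a  ≡⟨ correct′ a a≢s ⟩
        f′ a    ∎)
      where
      same-view : view V a f ≡ view V a f′
      same-view = view-cong V a λ c Vac → agree c (seen≢unseen V blind Vac)
      same-history : OthersCorrect f → OthersCorrect f′ → history I a (σ f) ≡ history I a (σ f′)
      same-history correct correct′ = begin
        history I a (σ f)                      ≡⟨ history-cong I a (λ c _ → update-id (σ f) s c) ⟨
        history I a (update (σ f) s (σ f s))   ≡⟨ cong (history I a ∘ update (σ f) s) same-s-guess ⟩
        history I a (update (σ f) s (σ f′ s))  ≡⟨ history-of-variant correct correct′ agree ⟨
        history I a (σ f′)                     ∎

    s-sees-others : {k₀ k₁ : K} → k₀ ≢ k₁ → (∀ a → V a a ≡ false) → (∀ a → a ≢ s → I s < I a) →
                    ∀ b → b ≢ s → V s b ≡ true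
    s-sees-others {k₀} {k₁} k₀≢k₁ irreflexive s-first b b≢s with V s b in Vsb
    ... | true  = refl
    ... | false = ⊥-elim (variant-changes-s-guess b≢s (irreflexive b) (agreeOff-update f b k₁)
                            (λ e → k₀≢k₁ (trans e (update-same f b k₁))) same-s-guess)
      where
      f : Fin n → K
      f _ = k₀
      same-s-guess : σ f s ≡ σ (update f b k₁) s
      same-s-guess = guess-cong s
        (history-cong I s λ c Ic<Is → contradiction Ic<Is (nothing-before-first s-first c))
        (view-cong V s λ c Vsc → agreeOff-update f b k₁ c (seen≢unseen V Vsb Vsc))

    s-guess-injective : DecidableEquality K → ∀ {a} → a ≢ s → V a a ≡ false → ∀ f →
                        Injective _≡_ _≡_ (λ k → σ (update f a k) s)
    s-guess-injective _≟K_ a≢s blind f {x} {y} same with x ≟K y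
    ... | yes x≡y = x≡y
    ... | no x≢y  = contradiction same (variant-changes-s-guess a≢s blind
        (λ c c≢a → trans (update-other f x c≢a) (sym (update-other f y c≢a)))
        (λ e → x≢y (trans (sym (update-same f _ x)) (trans e (update-same f _ y)))))

    s-entry-matters : (Σ ℕ λ m → K ↔ Fin m) → ∀ {a} → I s < I a → V a a ≡ false → ∀ f {k′} →
      k′ ≢ σ f s → S a (history I a (σ f)) (view V a f) ≢ S a (history I a (σ f) [ s ]≔ just k′) (view V a f)
    s-entry-matters finite {a} s<a blind f {k′} k′≢ same-answer =
      others-correct f λ correct → others-correct f′ λ correct′ → k′≢ (begin
        k′                      ≡⟨ hit ⟨
        σ f′ s                  ≡⟨ cong (λ k → σ (update f a k) s) (x≡fa correct correct′) ⟩
        σ (update f a (f a)) s  ≡⟨ guesses-cong (λ _ c _ → update-id f a c) s ⟩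
        σ f s                   ∎)
      where
      a≢s : a ≢ s
      a≢s refl = <-irrefl refl s<a
      K-decidable : DecidableEquality K
      K-decidable = inj⇒≟ (↔⇒↣ (proj₂ finite))
      preimage : ∃ λ x → σ (update f a x) s ≡ k′
      preimage = finite-injective⇒surjective finite _ (s-guess-injective K-decidable a≢s blind f) k′
      x : K
      x = proj₁ preimage
      hit : σ (update f a x) s ≡ k′
      hit = proj₂ preimage
      f′ : Fin n → K
      f′ = update f a x
      x≡fa : OthersCorrect f → OthersCorrect f′ → x ≡ f a
      x≡fa correct correct′ = begin
        x                                                    ≡⟨ update-same f a x ⟨
        f′ a                                                 ≡⟨ correct′ a a≢s ⟨
        σ f′ a                                               ≡⟨ guesses f′ a ⟩
        S a (history I a (σ f′)) (view V a f′)               ≡⟨ cong₂ (S a) history-after-x same-view ⟩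
        S a (history I a (σ f) [ s ]≔ just k′) (view V a f)  ≡⟨ same-answer ⟨
        S a (history I a (σ f)) (view V a f)                 ≡⟨ guesses f a ⟨
        σ f a                                                ≡⟨ correct a a≢s ⟩
        f a                                                  ∎
        where
        same-view : view V a f′ ≡ view V a f
        same-view = view-cong V a λ c Vac → update-other f x (seen≢unseen V blind Vac)
        history-after-x : history I a (σ f′) ≡ history I a (σ f) [ s ]≔ just k′
        history-after-x = trans (history-of-later-variant s<a correct correct′ (agreeOff-update f a x))
                                (cong (λ k → history I a (σ f) [ s ]≔ just k) hit)

proposition4p6 :
    (n : ℕ) → 2 ≤ n →
    (K : Set) → (k₀ k₁ : K) → k₀ ≢ k₁ →
    (V : Fin n → Fin n → Bool) → (∀ a → V a a ≡ false) →
    (I : Fin n → ℕ) → (IN : ℕ) →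
    (∀ a → 1 ≤ I a × I a ≤ IN) →
    (∀ β → 1 ≤ β → β ≤ IN → ∃ λ a → I a ≡ β) →
    2 ≤ IN →
    (s : Fin n) →
    -- (S1)  I_1 = {s}
    (∀ a → (I a ≡ 1 → a ≡ s) × (a ≡ s → I a ≡ 1)) →
    -- (S3)  V(a) ∩ H(a) = ∅
    (∀ a b → V a b ≡ true → ¬ (I b < I a)) →
    (S : Strategies n K) → (σ : (Fin n → K) → Fin n → K) → GuessesOf V I S σ →
    -- for every coloring at most one prisoner guesses incorrectly
    (∀ f a b → σ f a ≢ f a → σ f b ≢ f b → a ≡ b) →
    -- (1)  V(s) = A ∖ {s}
    (∀ b → (V s b ≡ true → b ≢ s) × (b ≢ s → V s b ≡ true))
    -- (2)
    × (∀ f a → σ f a ≢ f a → a ≡ s)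
    -- (3)
    × (∀ f a → a ≢ s → ∀ k′ → k′ ≢ f a → σ f s ≢ σ (update f a k′) s)
    -- (4)
    × ((Σ ℕ λ m → K ↔ Fin m) →
        ∀ f a → a ≢ s → ∀ k′ → k′ ≢ σ f s →
        S a (history I a (σ f)) (view V a f)
          ≢ S a (history I a (σ f) [ s ]≔ just k′) (view V a f))
proposition4p6 n _ K k₀ k₁ k₀≢k₁ V irreflexive I _ bounds _ _ s S1 S3 S σ guesses at-most-one-error =
  (λ b → seen≢unseen V (irreflexive s) , s-sees-others k₀≢k₁ irreflexive s-first b) ,
  only-s-errs ,
  (λ f a a≢s k′ k′≢fa → variant-changes-s-guess a≢s (irreflexive a) (agreeOff-update f a k′)
                          (λ e → k′≢fa (sym (trans e (update-same f a k′))))) ,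
  (λ finite f a a≢s k′ → s-entry-matters finite (s-first a a≢s) (irreflexive a) f)
  where
  open Game {V = V} {I = I} {S = S} guesses
  s-first : ∀ a → a ≢ s → I s < I a
  s-first = sole-first-inning (proj₁ ∘ bounds) (proj₁ ∘ S1) (proj₂ (S1 s) refl)
  only-s-errs : ∀ f a → σ f a ≢ f a → a ≡ s
  only-s-errs = unseen-only-error k₀≢k₁ s (first-unseen irreflexive S3 s-first) at-most-one-error
  open OnlyErrorAt s only-s-errs
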